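{- Let $w\ge2$ be even and let $E,E'$ be weighted Dedekind symbols of weight $w$ such that $E(h,k)-E(k,-h)=E'(h,k)-E'(k,-h)$ for all positive integers $h,k$. Then $E-E'=c\,G_w$ for some constant $c\in\mathbb C$, where $G_w(h,k)=\gcd(h,k)^w$.
   Context: A weighted Dedekind symbol of weight $w$ is a function $E:\mathbb Z^+\times\mathbb Z\to\mathbb C$ with $E(h,k)=E(h,k+h)$ for all $(h,k)$ and $E(ch,ck)=c^wE(h,k)$ for all $(h,k)$ and $c\in\mathbb Z^+$. $\gcd(h,0)=h$. -}

module Defs where

open import Level using (Level)
open import Data.Nat as ℕ using (ℕ; zero; suc; _≤_)
open import Data.Nat.GCD using (gcd)
open import Data.Integer as ℤ using (ℤ; +_; ∣_∣)
open import Algebra.Bundles using (CommutativeRing)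

module _ {a ℓ : Level} (R : CommutativeRing a ℓ) where
  open CommutativeRing R

  fromℕ : ℕ → Carrier
  fromℕ zero    = 0#
  fromℕ (suc n) = 1# + fromℕ n

  -- A weighted Dedekind symbol of weight w with values in R.
  -- E : ℤ⁺ × ℤ → R is modelled as E : ℕ → ℤ → R; only values with
  -- first argument h ≥ 1 are constrained/used.
  record IsWeightedDedekindSymbol (w : ℕ) (E : ℕ → ℤ → Carrier) : Set (a Level.⊔ ℓ) where
    field
      periodic    : ∀ (h : ℕ) (k : ℤ) → 1 ≤ h → E h k ≈ E h (k ℤ.+ + h)
      homogeneous : ∀ (c h : ℕ) (k : ℤ) → 1 ≤ c → 1 ≤ h →
                    E (c ℕ.* h) (+ c ℤ.* k) ≈ fromℕ (c ℕ.^ w) * E h k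

  G : ℕ → ℕ → ℤ → Carrier
  G w h k = fromℕ (gcd h ∣ k ∣ ℕ.^ w)

{-# OPTIONS --safe #-}
module Submission where

open import Defs
open import Level using (Level)
open import Data.Nat using (ℕ; _≤_)
open import Data.Nat.Divisibility using (_∣_)
open import Data.Integer as ℤ using (ℤ; +_)
open import Data.Product using (Σ; ∃)
open import Algebra.Bundles using (CommutativeRing)

open import Data.Nat as ℕ using (zero; suc; _<_; _^_; NonZero; >-nonZero; z<s)
open import Data.Nat.Divisibility using (∣-antisym)
open import Data.Nat.GCD using (gcd; gcd[m,n]∣m; gcd[m,n]∣n; gcd-greatest; gcd-comm; gcd-identityʳ)
open import Data.Nat.Induction using (<-rec)
import Data.Nat.Properties as ℕₚ
open import Data.Integer using (-[1+_]; ∣_∣) renaming (suc to sucℤ)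
open import Data.Integer.DivMod using (_%ℕ_; _/ℕ_; n%ℕd<d; a≡a%ℕn+[a/ℕn]*n)
import Data.Integer.Divisibility.Signed as ℤ∣
import Data.Integer.Properties as ℤₚ
open import Data.Product using (_,_)
open import Relation.Binary.Bundles using (Setoid)
open import Relation.Binary.PropositionalEquality as ≡ using (_≡_; cong; cong₂)
import Relation.Binary.Reasoning.Setoid as SetoidReasoning

-- Idea: D = E − E′ is again a weighted Dedekind symbol, and the hypothesis
-- says exactly that D is reciprocal, D(h,k) = D(k,−h). Periodicity reduces
-- k modulo h, and reciprocity swaps a nonzero residue r < h into the first
-- argument; this Euclidean descent ends at D(g,0) = g^w D(1,0) with
-- g = gcd(h,k), since the gcd is invariant under the same two moves.

module _ {c ℓ} (S : Setoid c ℓ) where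
  open Setoid S

  Periodic : ℕ → (ℤ → Carrier) → Set ℓ
  Periodic h f = ∀ k → f k ≈ f (k ℤ.+ + h)

  module _ {h} {f : ℤ → Carrier} (periodic : Periodic h f) where

    periodic-suc : ∀ q k → f (k ℤ.+ q ℤ.* + h) ≈ f (k ℤ.+ sucℤ q ℤ.* + h)
    periodic-suc q k = trans (periodic _) (reflexive (cong f shift))
      where
      open ≡.≡-Reasoning
      shift : k ℤ.+ q ℤ.* + h ℤ.+ + h ≡ k ℤ.+ sucℤ q ℤ.* + h
      shift = begin
        k ℤ.+ q ℤ.* + h ℤ.+ + h   ≡⟨ ℤₚ.+-assoc k (q ℤ.* + h) (+ h) ⟩
        k ℤ.+ (q ℤ.* + h ℤ.+ + h) ≡⟨ cong (ℤ._+_ k) (ℤₚ.+-comm (q ℤ.* + h) (+ h)) ⟩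
        k ℤ.+ (+ h ℤ.+ q ℤ.* + h) ≡⟨ cong (ℤ._+_ k) (ℤₚ.suc-* q (+ h)) ⟨
        k ℤ.+ sucℤ q ℤ.* + h      ∎

    periodic-multiple : ∀ q k → f k ≈ f (k ℤ.+ q ℤ.* + h)
    periodic-multiple (+ zero)        k = reflexive (cong f (≡.sym (ℤₚ.+-identityʳ k)))
    periodic-multiple (+ suc n)       k = trans (periodic-multiple (+ n) k) (periodic-suc (+ n) k)
    periodic-multiple -[1+ zero ]     k =
      sym (trans (periodic-suc -[1+ zero ] k) (reflexive (cong f (ℤₚ.+-identityʳ k))))
    periodic-multiple -[1+ suc n ]    k =
      trans (periodic-multiple -[1+ n ] k) (sym (periodic-suc -[1+ suc n ] k))

    periodic⇒≈%ℕ : .{{_ : NonZero h}} → ∀ k → f k ≈ f (+ (k %ℕ h))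
    periodic⇒≈%ℕ k = trans (reflexive (cong f (a≡a%ℕn+[a/ℕn]*n k h)))
                           (sym (periodic-multiple (k /ℕ h) (+ (k %ℕ h))))

gcd[m,∣n+m∣]≡gcd[m,∣n∣] : ∀ m n → gcd m ∣ n ℤ.+ + m ∣ ≡ gcd m ∣ n ∣
gcd[m,∣n+m∣]≡gcd[m,∣n∣] m n = ∣-antisym
  (gcd-greatest (gcd[m,n]∣m m _) (∣∣n+m∣⇒∣∣n∣ (gcd[m,n]∣m m _) (gcd[m,n]∣n m _)))
  (gcd-greatest (gcd[m,n]∣m m _) (∣∣n∣⇒∣∣n+m∣ (gcd[m,n]∣m m _) (gcd[m,n]∣n m _)))
  where
  ∣∣n+m∣⇒∣∣n∣ : ∀ {d} → d ∣ m → d ∣ ∣ n ℤ.+ + m ∣ → d ∣ ∣ n ∣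
  ∣∣n+m∣⇒∣∣n∣ {d} d∣m d∣n+m =
    ℤ∣.∣⇒∣ᵤ {+ d} {n} (ℤ∣.∣m+n∣n⇒∣m (ℤ∣.∣ᵤ⇒∣ {+ d} {n ℤ.+ + m} d∣n+m) (ℤ∣.∣ᵤ⇒∣ {+ d} {+ m} d∣m))

  ∣∣n∣⇒∣∣n+m∣ : ∀ {d} → d ∣ m → d ∣ ∣ n ∣ → d ∣ ∣ n ℤ.+ + m ∣
  ∣∣n∣⇒∣∣n+m∣ {d} d∣m d∣n =
    ℤ∣.∣⇒∣ᵤ {+ d} {n ℤ.+ + m} (ℤ∣.∣m∣n⇒∣m+n (ℤ∣.∣ᵤ⇒∣ {+ d} {n} d∣n) (ℤ∣.∣ᵤ⇒∣ {+ d} {+ m} d∣m))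

module _ {a ℓ} (R : CommutativeRing a ℓ) where
  open CommutativeRing R
  open import Algebra.Properties.Ring ring using (x[y-z]≈xy-xz)
  open import Algebra.Properties.AbelianGroup +-abelianGroup
    using (⁻¹-∙-comm; x∙y⁻¹≈ε⇒x≈y; x≈y⇒x∙y⁻¹≈ε)
  open import Algebra.Properties.CommutativeSemigroup +-commutativeSemigroup
    using (interchange)
  open SetoidReasoning setoid

  [x-y]-[u-v]≈[x-u]-[y-v] : ∀ x y u v → (x - y) - (u - v) ≈ (x - u) - (y - v)
  [x-y]-[u-v]≈[x-u]-[y-v] x y u v = begin
    (x - y) - (u - v)      ≈⟨ +-congˡ (⁻¹-∙-comm u (- v)) ⟨
    (x - y) + (- u - - v)  ≈⟨ interchange x (- y) (- u) (- - v) ⟩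
    (x - u) + (- y - - v)  ≈⟨ +-congˡ (⁻¹-∙-comm y (- v)) ⟩
    (x - u) - (y - v)      ∎

  x-y≈u-v⇒x-u≈y-v : ∀ {x y u v} → x - y ≈ u - v → x - u ≈ y - v
  x-y≈u-v⇒x-u≈y-v {x} {y} {u} {v} eq = x∙y⁻¹≈ε⇒x≈y _ _
    (trans ([x-y]-[u-v]≈[x-u]-[y-v] x u y v) (x≈y⇒x∙y⁻¹≈ε eq))

  isWeightedDedekindSymbol-difference : ∀ {w} {E E′ : ℕ → ℤ → Carrier} →
    IsWeightedDedekindSymbol R w E → IsWeightedDedekindSymbol R w E′ →
    IsWeightedDedekindSymbol R w (λ h k → E h k - E′ h k)
  isWeightedDedekindSymbol-difference isE isE′ = record
    { periodic    = λ h k 1≤h → +-cong (E.periodic h k 1≤h) (-‿cong (E′.periodic h k 1≤h))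
    ; homogeneous = λ c h k 1≤c 1≤h →
        trans (+-cong (E.homogeneous c h k 1≤c 1≤h) (-‿cong (E′.homogeneous c h k 1≤c 1≤h)))
              (sym (x[y-z]≈xy-xz _ _ _))
    }
    where
    module E  = IsWeightedDedekindSymbol isE
    module E′ = IsWeightedDedekindSymbol isE′

  symbol[h,0]≈h^w*symbol[1,0] : ∀ {w} {D : ℕ → ℤ → Carrier} → IsWeightedDedekindSymbol R w D →
    ∀ h → 1 ≤ h → D h (+ 0) ≈ fromℕ R (h ^ w) * D 1 (+ 0)
  symbol[h,0]≈h^w*symbol[1,0] {w} {D} isD h 1≤h = begin
    D h (+ 0)                       ≡⟨ cong₂ D (ℕₚ.*-identityʳ h) (ℤₚ.*-zeroʳ (+ h)) ⟨
    D (h ℕ.* 1) (+ h ℤ.* + 0)       ≈⟨ IsWeightedDedekindSymbol.homogeneous isD h 1 (+ 0) 1≤h ℕₚ.≤-refl ⟩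
    fromℕ R (h ^ w) * D 1 (+ 0)     ∎

  G-periodic : ∀ w h → Periodic setoid h (G R w h)
  G-periodic w h k = reflexive (cong (λ g → fromℕ R (g ^ w)) (≡.sym (gcd[m,∣n+m∣]≡gcd[m,∣n∣] h k)))

  G[h,0]≡h^w : ∀ w h → G R w h (+ 0) ≡ fromℕ R (h ^ w)
  G[h,0]≡h^w w h = cong (λ g → fromℕ R (g ^ w)) (gcd-identityʳ h)

  G[k,-h]≡G[h,k] : ∀ w h k → G R w k (ℤ.- + h) ≡ G R w h (+ k)
  G[k,-h]≡G[h,k] w h k = cong (λ g → fromℕ R (g ^ w))
    (≡.trans (cong (gcd k) (ℤₚ.∣-i∣≡∣i∣ (+ h))) (gcd-comm k h))

  Reciprocal : (ℕ → ℤ → Carrier) → Set ℓ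
  Reciprocal D = ∀ h k → 1 ≤ h → 1 ≤ k → D h (+ k) ≈ D k (ℤ.- + h)

  reciprocal⇒multiple-of-G : ∀ {w} {D : ℕ → ℤ → Carrier} →
    IsWeightedDedekindSymbol R w D → Reciprocal D →
    ∀ h k → 1 ≤ h → D h k ≈ D 1 (+ 0) * G R w h k
  reciprocal⇒multiple-of-G {w} {D} isD reciprocal h k 1≤h = <-rec P descent h 1≤h k
    where
    c : Carrier
    c = D 1 (+ 0)

    P : ℕ → Set ℓ
    P h = 1 ≤ h → ∀ k → D h k ≈ c * G R w h k

    descent : ∀ h → (∀ {m} → m < h → P m) → P h
    descent h P<h 1≤h k = begin
      D h k              ≈⟨ periodic⇒≈%ℕ setoid (λ k → periodic h k 1≤h) k ⟩
      D h (+ r)          ≈⟨ on-residues r (n%ℕd<d k h) ⟩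
      c * G R w h (+ r)  ≈⟨ *-congˡ (periodic⇒≈%ℕ setoid (G-periodic w h) k) ⟨
      c * G R w h k      ∎
      where
      open IsWeightedDedekindSymbol isD using (periodic)
      instance
        h≢0 : NonZero h
        h≢0 = >-nonZero 1≤h

      r : ℕ
      r = k %ℕ h

      on-residues : ∀ r → r < h → D h (+ r) ≈ c * G R w h (+ r)
      on-residues zero _ = begin
        D h (+ 0)             ≈⟨ symbol[h,0]≈h^w*symbol[1,0] isD h 1≤h ⟩
        fromℕ R (h ^ w) * c   ≈⟨ *-comm _ c ⟩
        c * fromℕ R (h ^ w)   ≡⟨ cong (c *_) (G[h,0]≡h^w w h) ⟨
        c * G R w h (+ 0)     ∎
      on-residues (suc r) r<h = begin
        D h (+ suc r)               ≈⟨ reciprocal h (suc r) 1≤h z<s ⟩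
        D (suc r) (ℤ.- + h)         ≈⟨ P<h r<h z<s (ℤ.- + h) ⟩
        c * G R w (suc r) (ℤ.- + h) ≡⟨ cong (c *_) (G[k,-h]≡G[h,k] w h (suc r)) ⟩
        c * G R w h (+ suc r)       ∎

-- The argument never uses that w is even or at least 2.
lemma2p5 : ∀ {a ℓ : Level} (R : CommutativeRing a ℓ) →
    let open CommutativeRing R in
    ∀ (w : ℕ) → 2 ≤ w → 2 ∣ w →
    ∀ (E E′ : ℕ → ℤ → Carrier) →
    IsWeightedDedekindSymbol R w E → IsWeightedDedekindSymbol R w E′ →
    (∀ (h k : ℕ) → 1 ≤ h → 1 ≤ k →
      E h (+ k) - E k (ℤ.- (+ h)) ≈ E′ h (+ k) - E′ k (ℤ.- (+ h))) →
    ∃ λ (c : Carrier) → ∀ (h : ℕ) (k : ℤ) → 1 ≤ h →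
      E h k - E′ h k ≈ c * G R w h k
lemma2p5 R w _ _ E E′ isE isE′ reciprocity-of-difference =
  D 1 (+ 0) , reciprocal⇒multiple-of-G R isD reciprocal
  where
  open CommutativeRing R using (Carrier; _-_)

  D : ℕ → ℤ → Carrier
  D h k = E h k - E′ h k

  isD : IsWeightedDedekindSymbol R w D
  isD = isWeightedDedekindSymbol-difference R isE isE′

  reciprocal : Reciprocal R D
  reciprocal h k 1≤h 1≤k = x-y≈u-v⇒x-u≈y-v R (reciprocity-of-difference h k 1≤h 1≤k)
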